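{- Let $k\ge1$ and $m>1$ be integers. The number of partitions in $Y^k_m$ is $m^k$.
   Context: For $1\le i\le k$ let $R_i=(i^{k+1-i})$, the rectangular partition with $k+1-i$ rows of length $i$. For partitions $\lambda,\mu$, $\lambda\cup\mu$ is the partition whose parts are those of $\lambda$ together with those of $\mu$, sorted into non-increasing order. A partition is $k$-bounded if all its parts are $\le k$. $Y^k_m$ is the set of $k$-bounded partitions $\lambda$ such that $\lambda\subseteq R_{i_1}\cup\cdots\cup R_{i_{m-1}}$ (containment of Young diagrams) for some $i_1,\dots,i_{m-1}\in\{1,\dots,k\}$. -}

module Defs where

open import Data.Nat using (ℕ; zero; suc; _∸_; _≤_; _≥_; _≤?_)
open import Data.Fin using (Fin; toℕ)
open import Data.List using (List; []; _∷_; replicate; foldr)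
open import Data.List.Relation.Unary.All using (All)
open import Data.List.Relation.Unary.Linked using (Linked)
open import Data.Vec as Vec using (Vec)
open import Data.Product using (Σ; _×_)
open import Relation.Nullary using (yes; no)

IsPartition : List ℕ → Set
IsPartition λs = Linked _≥_ λs × All (λ x → 1 ≤ x) λs

KBounded : ℕ → List ℕ → Set
KBounded k λs = All (λ x → x ≤ k) λs

-- i-th part (0-indexed), 0 beyond the length.
part : List ℕ → ℕ → ℕ
part []       _       = 0
part (x ∷ xs) zero    = x
part (x ∷ xs) (suc i) = part xs i

_⊆Y_ : List ℕ → List ℕ → Set
λs ⊆Y μs = ∀ i → part λs i ≤ part μs i

insert : ℕ → List ℕ → List ℕ
insert x [] = x ∷ []
insert x (y ∷ ys) with y ≤? x
... | yes _ = x ∷ y ∷ ys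
... | no  _ = y ∷ insert x ys

_∪P_ : List ℕ → List ℕ → List ℕ
λs ∪P μs = foldr insert μs λs

R : ℕ → ℕ → List ℕ
R k i = replicate (suc k ∸ i) i

-- R_{i_1} ∪ ... ∪ R_{i_n}, indices given as elements of Fin k (j ↦ i = j+1 ∈ {1..k}).
unionR : (k : ℕ) {n : ℕ} → Vec (Fin k) n → List ℕ
unionR k is = Vec.foldr _ (λ j acc → R k (suc (toℕ j)) ∪P acc) [] is

InY : ℕ → ℕ → List ℕ → Set
InY k m λs = IsPartition λs × KBounded k λs
           × Σ (Vec (Fin k) (m ∸ 1)) (λ is → λs ⊆Y unionR k is)

-- For partitions λ and μ, λ ⊆ μ iff their conjugates satisfy λ′ ⊆ μ′, and column j of
-- R_{i_1} ∪ ⋯ ∪ R_{i_n} has length Σ_{i_l ≥ j} (k + 1 − i_l). Hence coverings can be chosen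
-- greedily: a partition with largest part b is covered by s + 1 rectangles iff its parts after the
-- first k + 1 − b are covered by s of them, since a rectangle reaching column b has at most
-- k + 1 − b rows and may be replaced by R_b. Following this choice, the partitions with parts ≤ b
-- whose parts after the first r can be covered by s rectangles are listed by a recursion on
-- (s, b, r); their numbers obey Pascal's rule in (b, r) and equal Σ_t C(k,t) C(r+b−t, r) s^t.
-- For r = k − b trinomial revision C(k,t) C(k−t, k−b) = C(k,b) C(b,t) and the binomial theorem
-- turn this into C(k,b) (s + 1)^b, which is (s + 1)^k for b = k.

module Submission where

open import Defs

open import Data.Nat
  using (ℕ; zero; suc; _+_; _*_; _∸_; _^_; _≤_; _<_; _≥_; z≤n; s≤s; s≤s⁻¹; _≤?_; _<?_; NonZero; _!;
         +-0-rawMonoid; +-*-rawSemiring)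
open import Data.Nat.Properties
open import Data.Nat.Combinatorics using (_C_; nCn≡1; nCk≡nC[n∸k]; nCk+nC[k+1]≡[n+1]C[k+1]; k![n∸k]!∣n!)
open import Data.Nat.Combinatorics.Specification using (nCk≡n!/k![n-k]!; k>n⇒nCk≡0)
open import Data.Nat.DivMod using (_/_; m/n*n≡m)
open import Data.Nat.Tactic.RingSolver using (solve-∀)
open import Data.Fin as Fin using (Fin; toℕ; fromℕ<)
open import Data.Fin.Properties using (toℕ-inject₁; toℕ-fromℕ; toℕ-fromℕ<; toℕ≤pred[n])
open import Data.Vec as Vec using (Vec; []; _∷_)
open import Data.List using (List; []; _∷_; _++_; length; filter; drop; replicate; map)
open import Data.List.Properties
  using (length-++; length-map; length-filter; length-replicate; drop-[]; ∷-injectiveʳ;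
         filter-++; filter-all; filter-none; filter-accept)
open import Data.List.Relation.Unary.All as All using (All; []; _∷_)
open import Data.List.Relation.Unary.All.Properties using (replicate⁺)
open import Data.List.Relation.Unary.AllPairs using ([]; _∷_)
open import Data.List.Relation.Unary.Any using (here)
open import Data.List.Relation.Unary.Linked as Linked using (Linked; []; [-]; _∷_)
open import Data.List.Relation.Unary.Linked.Properties using (Linked⇒All)
open import Data.List.Relation.Unary.Unique.Propositional using (Unique)
import Data.List.Relation.Unary.Unique.Propositional.Properties as UniqueProperties
open import Data.List.Membership.Propositional using (_∈_)
open import Data.List.Membership.Propositional.Properties using (∈-++⁺ˡ; ∈-++⁺ʳ; ∈-++⁻; ∈-map⁺; map∷⁻)
open import Data.List.Relation.Binary.Permutation.Propositional using (_↭_; ↭-refl)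
open import Data.List.Relation.Binary.Permutation.Propositional.Properties using (↭-length; filter-↭)
import Data.List.Sort.InsertionSort.Base as InsertionSort
import Data.List.Sort.InsertionSort.Properties as InsertionSortProperties
open import Data.Product using (Σ; _×_; _,_; proj₁; ∃; ∃₂)
open import Data.Sum using (_⊎_; inj₁; inj₂)
open import Data.Empty using (⊥-elim)
open import Level using (0ℓ)
open import Function.Bundles using (_⇔_; mk⇔; module Equivalence)
open import Function.Properties.Equivalence using () renaming (trans to ⇔-trans; sym to ⇔-sym)
open import Relation.Nullary using (yes; no; ¬_)
open import Relation.Nullary.Decidable using (dec-true; dec-false)
open import Relation.Binary.Bundles using (DecTotalOrder)
open import Relation.Binary.Construct.Flip.EqAndOrd using (decTotalOrder)
open import Relation.Binary.PropositionalEquality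
  using (_≡_; refl; sym; trans; cong; cong₂; subst; module ≡-Reasoning)
open import Algebra.Properties.CommutativeSemigroup +-commutativeSemigroup using (x∙yz≈y∙xz)
open import Algebra.Properties.Semiring.Sum +-*-semiring
  using (sum; sum-init-last; sum-cong-≗; ∑-distrib-+; *-distribˡ-sum)
import Algebra.Definitions.RawMonoid +-0-rawMonoid as Monoid
import Algebra.Definitions.RawSemiring +-*-rawSemiring as Semiring
import Algebra.Properties.CommutativeSemiring.Binomial +-*-commutativeSemiring as Binomial

-- Sums and binomial coefficients

∑≤ : ℕ → (ℕ → ℕ) → ℕ
∑≤ n f = sum {suc n} (λ t → f (toℕ t))

∑≤-last : ∀ n f → ∑≤ (suc n) f ≡ ∑≤ n f + f (suc n)
∑≤-last n f = trans (sum-init-last {suc n} (λ t → f (toℕ t)))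
  (cong₂ _+_ (sum-cong-≗ {suc n} (λ t → cong f (toℕ-inject₁ t))) (cong f (toℕ-fromℕ (suc n))))

∑≤-cong : ∀ n {f g} → (∀ t → t ≤ n → f t ≡ g t) → ∑≤ n f ≡ ∑≤ n g
∑≤-cong n f≗g = sum-cong-≗ (λ t → f≗g (toℕ t) (toℕ≤pred[n] t))

∑≤-distrib-+ : ∀ n f g → ∑≤ n (λ t → f t + g t) ≡ ∑≤ n f + ∑≤ n g
∑≤-distrib-+ n f g = ∑-distrib-+ {suc n} (λ t → f (toℕ t)) (λ t → g (toℕ t))

*-distribˡ-∑≤ : ∀ n c f → c * ∑≤ n f ≡ ∑≤ n (λ t → c * f t)
*-distribˡ-∑≤ n c f = *-distribˡ-sum {suc n} c (λ t → f (toℕ t))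

binomialTheorem : ∀ n s → suc s ^ n ≡ ∑≤ n (λ t → (n C t) * s ^ t)
binomialTheorem n s = begin
  suc s ^ n                        ≡⟨ cong (_^ n) (+-comm 1 s) ⟩
  (s + 1) ^ n                      ≡⟨ sym (^-semiring (s + 1) n) ⟩
  (s + 1) Semiring.^ n             ≡⟨ Binomial.theorem n s 1 ⟩
  Binomial.binomialExpansion s 1 n ≡⟨ sum-cong-≗ term ⟩
  ∑≤ n (λ t → (n C t) * s ^ t)     ∎
  where
  open ≡-Reasoning
  -- The library states the theorem with the semiring's own power and ℕ-multiple, which agree with
  -- _^_ and _*_ on ℕ only propositionally.
  ^-semiring : ∀ m n → m Semiring.^ n ≡ m ^ n
  ^-semiring m zero = refl
  ^-semiring m (suc n) = cong (m *_) (^-semiring m n)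
  ×≡* : ∀ m n → m Monoid.× n ≡ m * n
  ×≡* zero n = refl
  ×≡* (suc m) n = cong (n +_) (×≡* m n)
  term : ∀ (t : Fin (suc n)) →
    (n C toℕ t) Monoid.× (s Semiring.^ toℕ t * 1 Semiring.^ (n ∸ toℕ t)) ≡ (n C toℕ t) * s ^ toℕ t
  term t rewrite ×≡* (n C toℕ t) (s Semiring.^ toℕ t * 1 Semiring.^ (n ∸ toℕ t))
               | ^-semiring s (toℕ t) | ^-semiring 1 (n ∸ toℕ t) | ^-zeroˡ (n ∸ toℕ t)
               | *-identityʳ (s ^ toℕ t) = refl

nC0≡1 : ∀ n → n C 0 ≡ 1
nC0≡1 n = trans (nCk≡nC[n∸k] (z≤n {n})) (nCn≡1 n)

nCk*k!*[n∸k]!≡n! : ∀ {n k} → k ≤ n → (n C k) * (k ! * (n ∸ k) !) ≡ n !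
nCk*k!*[n∸k]!≡n! {n} {k} k≤n = begin
  (n C k) * (k ! * (n ∸ k) !)                  ≡⟨ cong (_* (k ! * (n ∸ k) !)) (nCk≡n!/k![n-k]! k≤n) ⟩
  n ! / (k ! * (n ∸ k) !) * (k ! * (n ∸ k) !)  ≡⟨ m/n*n≡m (k![n∸k]!∣n! k≤n) ⟩
  n !                                          ∎
  where
  open ≡-Reasoning
  instance
    k![n∸k]!≢0 : NonZero (k ! * (n ∸ k) !)
    k![n∸k]!≢0 = k !* (n ∸ k) !≢0

[n∸t]∸[n∸x]≡x∸t : ∀ {n x t} → t ≤ x → x ≤ n → (n ∸ t) ∸ (n ∸ x) ≡ x ∸ t
[n∸t]∸[n∸x]≡x∸t {n} {x} {t} t≤x x≤n = begin
  (n ∸ t) ∸ (n ∸ x)                 ≡⟨ cong (λ m → (m ∸ t) ∸ (n ∸ x)) (m∸n+n≡m x≤n) ⟨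
  ((n ∸ x) + x ∸ t) ∸ (n ∸ x)       ≡⟨ cong (_∸ (n ∸ x)) (+-∸-assoc (n ∸ x) t≤x) ⟩
  ((n ∸ x) + (x ∸ t)) ∸ (n ∸ x)     ≡⟨ m+n∸m≡n (n ∸ x) (x ∸ t) ⟩
  x ∸ t                             ∎
  where open ≡-Reasoning

nCt*[n∸t]C[n∸x]≡nCx*xCt : ∀ {n x t} → t ≤ x → x ≤ n →
  (n C t) * ((n ∸ t) C (n ∸ x)) ≡ (n C x) * (x C t)
nCt*[n∸t]C[n∸x]≡nCx*xCt {n} {x} {t} t≤x x≤n = *-cancelʳ-≡ _ _ t![n∸x]![x∸t]! (trans lhs (sym rhs))
  where
  open ≡-Reasoning
  t![n∸x]![x∸t]! : ℕ
  t![n∸x]![x∸t]! = t ! * ((n ∸ x) ! * (x ∸ t) !)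
  instance
    t![n∸x]![x∸t]!≢0 : NonZero t![n∸x]![x∸t]!
    t![n∸x]![x∸t]!≢0 = m*n≢0 (t !) ((n ∸ x) ! * (x ∸ t) !) {{t !≢0}} {{(n ∸ x) !* (x ∸ t) !≢0}}
  regroupˡ : ∀ a b c d e → a * b * (c * (d * e)) ≡ a * (c * (b * (d * e)))
  regroupˡ = solve-∀
  regroupʳ : ∀ a b c d e → a * b * (c * (d * e)) ≡ a * (b * (c * e) * d)
  regroupʳ = solve-∀
  lhs : (n C t) * ((n ∸ t) C (n ∸ x)) * t![n∸x]![x∸t]! ≡ n !
  lhs = begin
    (n C t) * ((n ∸ t) C (n ∸ x)) * t![n∸x]![x∸t]!
      ≡⟨ regroupˡ (n C t) ((n ∸ t) C (n ∸ x)) (t !) ((n ∸ x) !) ((x ∸ t) !) ⟩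
    (n C t) * (t ! * (((n ∸ t) C (n ∸ x)) * ((n ∸ x) ! * (x ∸ t) !)))
      ≡⟨ cong (λ d → (n C t) * (t ! * (((n ∸ t) C (n ∸ x)) * ((n ∸ x) ! * d !))))
              ([n∸t]∸[n∸x]≡x∸t t≤x x≤n) ⟨
    (n C t) * (t ! * (((n ∸ t) C (n ∸ x)) * ((n ∸ x) ! * ((n ∸ t) ∸ (n ∸ x)) !)))
      ≡⟨ cong (λ d → (n C t) * (t ! * d)) (nCk*k!*[n∸k]!≡n! (∸-monoʳ-≤ n t≤x)) ⟩
    (n C t) * (t ! * (n ∸ t) !)
      ≡⟨ nCk*k!*[n∸k]!≡n! (≤-trans t≤x x≤n) ⟩
    n !  ∎
  rhs : (n C x) * (x C t) * t![n∸x]![x∸t]! ≡ n !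
  rhs = begin
    (n C x) * (x C t) * t![n∸x]![x∸t]!
      ≡⟨ regroupʳ (n C x) (x C t) (t !) ((n ∸ x) !) ((x ∸ t) !) ⟩
    (n C x) * ((x C t) * (t ! * (x ∸ t) !) * (n ∸ x) !)
      ≡⟨ cong (λ d → (n C x) * (d * (n ∸ x) !)) (nCk*k!*[n∸k]!≡n! t≤x) ⟩
    (n C x) * (x ! * (n ∸ x) !)
      ≡⟨ nCk*k!*[n∸k]!≡n! x≤n ⟩
    n !  ∎

-- Counting

module CoverableCount (k : ℕ) where

  coverableCount : ℕ → ℕ → ℕ → ℕ
  coverableCount s b r = ∑≤ b (λ t → (k C t) * ((r + b ∸ t) C r) * s ^ t)

  coverableCount-base : ∀ s r → coverableCount s 0 r ≡ 1
  coverableCount-base s r rewrite nC0≡1 k | +-identityʳ r | nCn≡1 r = refl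

  coverableCount-pascal : ∀ s b r →
    coverableCount s (suc b) (suc r) ≡ coverableCount s b (suc r) + coverableCount s (suc b) r
  coverableCount-pascal s b r = begin
    ∑≤ (suc b) T                       ≡⟨ ∑≤-cong (suc b) split ⟩
    ∑≤ (suc b) (λ t → A t + B t)       ≡⟨ ∑≤-distrib-+ (suc b) A B ⟩
    ∑≤ (suc b) A + ∑≤ (suc b) B        ≡⟨ cong (_+ ∑≤ (suc b) B) (∑≤-last b A) ⟩
    ∑≤ b A + A (suc b) + ∑≤ (suc b) B  ≡⟨ cong (λ a → ∑≤ b A + a + ∑≤ (suc b) B) A[1+b]≡0 ⟩
    ∑≤ b A + 0 + ∑≤ (suc b) B          ≡⟨ cong (_+ ∑≤ (suc b) B) (+-identityʳ (∑≤ b A)) ⟩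
    ∑≤ b A + ∑≤ (suc b) B              ∎
    where
    open ≡-Reasoning
    T A B : ℕ → ℕ
    T t = (k C t) * ((suc r + suc b ∸ t) C suc r) * s ^ t
    A t = (k C t) * ((suc r + b ∸ t) C suc r) * s ^ t
    B t = (k C t) * ((r + suc b ∸ t) C r) * s ^ t
    distrib : ∀ a x y z → a * (x + y) * z ≡ a * y * z + a * x * z
    distrib = solve-∀
    split : ∀ t → t ≤ suc b → T t ≡ A t + B t
    split t t≤1+b = begin
      (k C t) * ((suc r + suc b ∸ t) C suc r) * s ^ t
        ≡⟨ cong (λ m → (k C t) * (m C suc r) * s ^ t) (+-∸-assoc 1 (≤-trans t≤1+b (m≤n+m (suc b) r))) ⟩
      (k C t) * (suc (r + suc b ∸ t) C suc r) * s ^ t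
        ≡⟨ cong (λ c → (k C t) * c * s ^ t) (nCk+nC[k+1]≡[n+1]C[k+1] (r + suc b ∸ t) r) ⟨
      (k C t) * ((r + suc b ∸ t) C r + (r + suc b ∸ t) C suc r) * s ^ t
        ≡⟨ distrib (k C t) ((r + suc b ∸ t) C r) ((r + suc b ∸ t) C suc r) (s ^ t) ⟩
      (k C t) * ((r + suc b ∸ t) C suc r) * s ^ t + B t
        ≡⟨ cong (λ m → (k C t) * ((m ∸ t) C suc r) * s ^ t + B t) (+-suc r b) ⟩
      A t + B t  ∎
    A[1+b]≡0 : A (suc b) ≡ 0
    A[1+b]≡0 = begin
      (k C suc b) * ((suc r + b ∸ suc b) C suc r) * s ^ suc b
        ≡⟨ cong (λ m → (k C suc b) * (m C suc r) * s ^ suc b) (m+n∸n≡m r b) ⟩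
      (k C suc b) * (r C suc r) * s ^ suc b
        ≡⟨ cong (λ c → (k C suc b) * c * s ^ suc b) (k>n⇒nCk≡0 (n<1+n r)) ⟩
      (k C suc b) * 0 * s ^ suc b
        ≡⟨ cong (_* s ^ suc b) (*-zeroʳ (k C suc b)) ⟩
      0  ∎

  coverableCount-r≡0 : ∀ s b → coverableCount s b 0 ≡ ∑≤ b (λ t → (k C t) * s ^ t)
  coverableCount-r≡0 s b = ∑≤-cong b λ t _ →
    trans (cong (λ c → (k C t) * c * s ^ t) (nC0≡1 (b ∸ t))) (cong (_* s ^ t) (*-identityʳ (k C t)))

  coverableCount-step : ∀ s b →
    coverableCount s (suc b) 0 ≡ coverableCount s b 0 + (k C suc b) * s ^ suc b
  coverableCount-step s b = begin
    coverableCount s (suc b) 0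
      ≡⟨ coverableCount-r≡0 s (suc b) ⟩
    ∑≤ (suc b) (λ t → (k C t) * s ^ t)
      ≡⟨ ∑≤-last b (λ t → (k C t) * s ^ t) ⟩
    ∑≤ b (λ t → (k C t) * s ^ t) + (k C suc b) * s ^ suc b
      ≡⟨ cong (_+ (k C suc b) * s ^ suc b) (coverableCount-r≡0 s b) ⟨
    coverableCount s b 0 + (k C suc b) * s ^ suc b  ∎
    where open ≡-Reasoning

  coverableCount-diagonal : ∀ s {x} → x ≤ k → coverableCount s x (k ∸ x) ≡ (k C x) * suc s ^ x
  coverableCount-diagonal s {x} x≤k = begin
    coverableCount s x (k ∸ x)                ≡⟨ ∑≤-cong x revision ⟩
    ∑≤ x (λ t → (k C x) * ((x C t) * s ^ t))  ≡⟨ *-distribˡ-∑≤ x (k C x) (λ t → (x C t) * s ^ t) ⟨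
    (k C x) * ∑≤ x (λ t → (x C t) * s ^ t)    ≡⟨ cong ((k C x) *_) (binomialTheorem x s) ⟨
    (k C x) * suc s ^ x                       ∎
    where
    open ≡-Reasoning
    revision : ∀ t → t ≤ x → (k C t) * ((k ∸ x + x ∸ t) C (k ∸ x)) * s ^ t ≡ (k C x) * ((x C t) * s ^ t)
    revision t t≤x = begin
      (k C t) * ((k ∸ x + x ∸ t) C (k ∸ x)) * s ^ t
        ≡⟨ cong (λ m → (k C t) * ((m ∸ t) C (k ∸ x)) * s ^ t) (m∸n+n≡m x≤k) ⟩
      (k C t) * ((k ∸ t) C (k ∸ x)) * s ^ t
        ≡⟨ cong (_* s ^ t) (nCt*[n∸t]C[n∸x]≡nCx*xCt t≤x x≤k) ⟩
      (k C x) * (x C t) * s ^ t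
        ≡⟨ *-assoc (k C x) (x C t) (s ^ t) ⟩
      (k C x) * ((x C t) * s ^ t)  ∎

  coverableCount-total : ∀ s → coverableCount s k 0 ≡ suc s ^ k
  coverableCount-total s = begin
    coverableCount s k 0        ≡⟨ cong (coverableCount s k) (n∸n≡0 k) ⟨
    coverableCount s k (k ∸ k)  ≡⟨ coverableCount-diagonal s ≤-refl ⟩
    (k C k) * suc s ^ k         ≡⟨ cong (_* suc s ^ k) (nCn≡1 k) ⟩
    1 * suc s ^ k               ≡⟨ *-identityˡ (suc s ^ k) ⟩
    suc s ^ k                   ∎
    where open ≡-Reasoning

-- Conjugate partitions

-- conj λs j is the length of column j of the diagram, indexed from 0 like part.
conj : List ℕ → ℕ → ℕ
conj λs j = length (filter (j <?_) λs)

_⊆Y′_ : List ℕ → List ℕ → Set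
λs ⊆Y′ μs = ∀ j → conj λs j ≤ conj μs j

conj-++ : ∀ xs ys j → conj (xs ++ ys) j ≡ conj xs j + conj ys j
conj-++ xs ys j = trans (cong length (filter-++ (j <?_) xs ys)) (length-++ (filter (j <?_) xs))

conj-↭ : ∀ {xs ys} j → xs ↭ ys → conj xs j ≡ conj ys j
conj-↭ j xs↭ys = ↭-length (filter-↭ (j <?_) xs↭ys)

conj-≡0 : ∀ {xs j} → All (_≤ j) xs → conj xs j ≡ 0
conj-≡0 {j = j} xs≤j = cong length (filter-none (j <?_) (All.map ≤⇒≯ xs≤j))

conj-∷-< : ∀ {y j} ys → j < y → conj (y ∷ ys) j ≡ suc (conj ys j)
conj-∷-< {j = j} ys j<y = cong length (filter-accept (j <?_) j<y)

descending⇒All≤ : ∀ {y ys c} → Linked _≥_ (y ∷ ys) → y ≤ c → All (_≤ c) (y ∷ ys)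
descending⇒All≤ sorted y≤c = Linked⇒All (λ c≥x x≥y → ≤-trans x≥y c≥x) y≤c sorted

part≤ : ∀ {c} xs → All (_≤ c) xs → ∀ i → part xs i ≤ c
part≤ [] _ i = z≤n
part≤ (x ∷ xs) (x≤c ∷ _) zero = x≤c
part≤ (x ∷ xs) (_ ∷ xs≤c) (suc i) = part≤ xs xs≤c i

<conj⇒<part : ∀ {λs i j} → Linked _≥_ λs → i < conj λs j → j < part λs i
<conj⇒<part {y ∷ λs} {i} {j} sorted i<conj with j <? y
<conj⇒<part {y ∷ λs} {zero}  sorted _ | yes j<y = j<y
<conj⇒<part {y ∷ λs} {suc i} sorted i<conj | yes j<y =
  <conj⇒<part (Linked.tail sorted) (s≤s⁻¹ (subst (suc i <_) (conj-∷-< λs j<y) i<conj))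
... | no j≮y = ⊥-elim (n≮0 (subst (i <_) (conj-≡0 (descending⇒All≤ sorted (≮⇒≥ j≮y))) i<conj))

<part⇒<conj : ∀ {λs i j} → Linked _≥_ λs → j < part λs i → i < conj λs j
<part⇒<conj {y ∷ λs} {i} {j} sorted j<part with j <? y
<part⇒<conj {y ∷ λs} {zero}  sorted _ | yes j<y rewrite conj-∷-< λs j<y = s≤s z≤n
<part⇒<conj {y ∷ λs} {suc i} sorted j<part | yes j<y rewrite conj-∷-< λs j<y =
  s≤s (<part⇒<conj (Linked.tail sorted) j<part)
... | no j≮y = ⊥-elim (j≮y (<-≤-trans j<part (part≤ (y ∷ λs) (descending⇒All≤ sorted ≤-refl) i)))

≤-by-< : ∀ {m n} → (∀ {i} → i < m → i < n) → m ≤ n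
≤-by-< {zero} _ = z≤n
≤-by-< {suc m} below = below (n<1+n m)

⊆Y⇔⊆Y′ : ∀ {λs μs} → Linked _≥_ λs → Linked _≥_ μs → (λs ⊆Y μs) ⇔ (λs ⊆Y′ μs)
⊆Y⇔⊆Y′ λ-sorted μ-sorted = mk⇔
  (λ λ⊆μ j → ≤-by-< λ i<conj → <part⇒<conj μ-sorted (<-≤-trans (<conj⇒<part λ-sorted i<conj) (λ⊆μ _)))
  (λ λ⊆′μ i → ≤-by-< λ j<part → <conj⇒<part μ-sorted (<-≤-trans (<part⇒<conj λ-sorted j<part) (λ⊆′μ _)))

conj-drop : ∀ {λs} n j → Linked _≥_ λs → conj (drop n λs) j ≡ conj λs j ∸ n
conj-drop zero j _ = refl
conj-drop {[]} (suc n) j _ = refl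
conj-drop {y ∷ λs} (suc n) j sorted with j <? y
... | yes j<y = trans (conj-drop n j (Linked.tail sorted)) (cong (_∸ suc n) (sym (conj-∷-< λs j<y)))
... | no j≮y = begin
  conj (drop n λs) j         ≡⟨ conj-drop n j (Linked.tail sorted) ⟩
  conj λs j ∸ n              ≡⟨ cong (_∸ n) λs-empty ⟩
  0 ∸ n                      ≡⟨ 0∸n≡0 n ⟩
  0                          ≡⟨ cong (_∸ suc n) (conj-≡0 y∷λs≤j) ⟨
  conj (y ∷ λs) j ∸ suc n    ∎
  where
  open ≡-Reasoning
  y∷λs≤j : All (_≤ j) (y ∷ λs)
  y∷λs≤j = descending⇒All≤ sorted (≮⇒≥ j≮y)
  λs-empty : conj λs j ≡ 0
  λs-empty = conj-≡0 (All.tail y∷λs≤j)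

≥-decTotalOrder : DecTotalOrder 0ℓ 0ℓ 0ℓ
≥-decTotalOrder = decTotalOrder ≤-decTotalOrder

module Descending = InsertionSortProperties ≥-decTotalOrder

insert≡descending-insert : ∀ x ys → insert x ys ≡ InsertionSort.insert ≥-decTotalOrder x ys
insert≡descending-insert x [] = refl
insert≡descending-insert x (y ∷ ys) with y ≤? x
... | yes y≤x rewrite dec-true (y ≤? x) y≤x = refl
... | no y≰x rewrite dec-false (y ≤? x) y≰x = cong (y ∷_) (insert≡descending-insert x ys)

∪P-↭ : ∀ λs μs → λs ∪P μs ↭ λs ++ μs
∪P-↭ [] μs = ↭-refl
∪P-↭ (y ∷ λs) μs = subst (_↭ y ∷ λs ++ μs) (sym (insert≡descending-insert y (λs ∪P μs)))
  (Descending.insert-cong-↭ (∪P-↭ λs μs))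

∪P-sorted : ∀ λs {μs} → Linked _≥_ μs → Linked _≥_ (λs ∪P μs)
∪P-sorted [] μ-sorted = μ-sorted
∪P-sorted (y ∷ λs) μ-sorted = subst (Linked _≥_) (sym (insert≡descending-insert y (λs ∪P _)))
  (Descending.insert-↗ y (∪P-sorted λs μ-sorted))

conj-∪P : ∀ λs μs j → conj (λs ∪P μs) j ≡ conj λs j + conj μs j
conj-∪P λs μs j = trans (conj-↭ j (∪P-↭ λs μs)) (conj-++ λs μs j)

-- Coverings by rectangles

module Rectangles (k : ℕ) where

  conj-R-≤ : ∀ i c → conj (R k i) c ≤ suc k ∸ i
  conj-R-≤ i c = ≤-trans (length-filter (c <?_) (R k i)) (≤-reflexive (length-replicate (suc k ∸ i)))

  conj-R-< : ∀ {i c} → c < i → conj (R k i) c ≡ suc k ∸ i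
  conj-R-< {i} {c} c<i =
    trans (cong length (filter-all (c <?_) (replicate⁺ (suc k ∸ i) c<i))) (length-replicate (suc k ∸ i))

  conj-R-≥ : ∀ {i c} → i ≤ c → conj (R k i) c ≡ 0
  conj-R-≥ {i} i≤c = conj-≡0 (replicate⁺ (suc k ∸ i) i≤c)

  unionR-sorted : ∀ {n} (is : Vec (Fin k) n) → Linked _≥_ (unionR k is)
  unionR-sorted [] = []
  unionR-sorted (i ∷ is) = ∪P-sorted (R k (suc (toℕ i))) (unionR-sorted is)

  conj-unionR-∷ : ∀ {n} i (is : Vec (Fin k) n) c →
    conj (unionR k (i ∷ is)) c ≡ conj (R k (suc (toℕ i))) c + conj (unionR k is) c
  conj-unionR-∷ i is = conj-∪P (R k (suc (toℕ i))) (unionR k is)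

  Covered : ℕ → List ℕ → Set
  Covered s λs = Σ (Vec (Fin k) s) λ is → λs ⊆Y′ unionR k is

  covered-[] : Fin k → ∀ s → Covered s []
  covered-[] i s = Vec.replicate s i , λ _ → z≤n

  ¬covered-by-none : ∀ {b λs} → ¬ Covered 0 (suc b ∷ λs)
  ¬covered-by-none {b} {λs} ([] , λ⊆′∅) =
    n≮0 (subst (_≤ 0) (conj-∷-< {suc b} {0} λs (s≤s z≤n)) (λ⊆′∅ 0))

  removeRectangle : ∀ {s} c (is : Vec (Fin k) (suc s)) → 0 < conj (unionR k is) c →
    ∃₂ λ (i : Fin k) (is′ : Vec (Fin k) s) → c ≤ toℕ i ×
      (∀ c′ → conj (unionR k is) c′ ≡ conj (R k (suc (toℕ i))) c′ + conj (unionR k is′) c′)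
  removeRectangle c (i ∷ is) 0<conj with c ≤? toℕ i
  ... | yes c≤i = i , is , c≤i , conj-unionR-∷ i is
  removeRectangle c (i ∷ []) 0<conj | no c≰i =
    ⊥-elim (n≮0 (subst (0 <_) (trans (conj-unionR-∷ i [] c) (cong (_+ 0) (conj-R-≥ (≰⇒> c≰i)))) 0<conj))
  removeRectangle c (i ∷ i′ ∷ is) 0<conj | no c≰i
    with removeRectangle c (i′ ∷ is)
           (subst (0 <_) (trans (conj-unionR-∷ i (i′ ∷ is) c) (cong (_+ _) (conj-R-≥ (≰⇒> c≰i)))) 0<conj)
  ... | j , is′ , c≤j , split = j , i ∷ is′ , c≤j , λ c′ → begin
    conj (unionR k (i ∷ i′ ∷ is)) c′              ≡⟨ conj-unionR-∷ i (i′ ∷ is) c′ ⟩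
    conj (Rᵢ i) c′ + conj (unionR k (i′ ∷ is)) c′  ≡⟨ cong (conj (Rᵢ i) c′ +_) (split c′) ⟩
    conj (Rᵢ i) c′ + (conj (Rᵢ j) c′ + conj (unionR k is′) c′)
                                                  ≡⟨ x∙yz≈y∙xz (conj (Rᵢ i) c′) (conj (Rᵢ j) c′) _ ⟩
    conj (Rᵢ j) c′ + (conj (Rᵢ i) c′ + conj (unionR k is′) c′)
                                                  ≡⟨ cong (conj (Rᵢ j) c′ +_) (conj-unionR-∷ i is′ c′) ⟨
    conj (Rᵢ j) c′ + conj (unionR k (i ∷ is′)) c′  ∎
    where
    open ≡-Reasoning
    Rᵢ : Fin k → List ℕ
    Rᵢ i = R k (suc (toℕ i))

  covered-∷⁺ : ∀ {s b λs} → Linked _≥_ (suc b ∷ λs) → suc b ≤ k →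
    Covered s (drop (k ∸ suc b) λs) → Covered (suc s) (suc b ∷ λs)
  covered-∷⁺ {s} {b} {λs} sorted 1+b≤k (is , covers) = i ∷ is , covers′
    where
    i : Fin k
    i = fromℕ< 1+b≤k
    covers′ : ∀ c → conj (suc b ∷ λs) c ≤ conj (unionR k (i ∷ is)) c
    covers′ c rewrite conj-unionR-∷ i is c | toℕ-fromℕ< 1+b≤k with c <? suc b
    ... | no c≮1+b = ≤-trans (≤-reflexive (conj-≡0 (descending⇒All≤ sorted (≮⇒≥ c≮1+b)))) z≤n
    ... | yes c<1+b rewrite conj-R-< c<1+b = begin
      conj (suc b ∷ λs) c
        ≤⟨ m≤n+m∸n _ (suc (k ∸ suc b)) ⟩
      suc (k ∸ suc b) + (conj (suc b ∷ λs) c ∸ suc (k ∸ suc b))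
        ≡⟨ cong (suc (k ∸ suc b) +_) (conj-drop (suc (k ∸ suc b)) c sorted) ⟨
      suc (k ∸ suc b) + conj (drop (k ∸ suc b) λs) c
        ≤⟨ +-monoʳ-≤ (suc (k ∸ suc b)) (covers c) ⟩
      suc (k ∸ suc b) + conj (unionR k is) c
        ≡⟨ cong (_+ conj (unionR k is) c) (+-∸-assoc 1 1+b≤k) ⟨
      (k ∸ b) + conj (unionR k is) c  ∎
      where open ≤-Reasoning

  covered-∷⁻ : ∀ {s b λs} → Linked _≥_ (suc b ∷ λs) → suc b ≤ k →
    Covered (suc s) (suc b ∷ λs) → Covered s (drop (k ∸ suc b) λs)
  covered-∷⁻ {s} {b} {λs} sorted 1+b≤k (is , covers)
    with removeRectangle b is (≤-trans (s≤s z≤n) (subst (_≤ _) (conj-∷-< λs (n<1+n b)) (covers b)))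
  ... | i , is′ , b≤i , split = is′ , covers′
    where
    covers′ : ∀ c → conj (drop (k ∸ suc b) λs) c ≤ conj (unionR k is′) c
    covers′ c rewrite conj-drop (suc (k ∸ suc b)) c sorted = m≤n+o⇒m∸n≤o _ (suc (k ∸ suc b)) (begin
      conj (suc b ∷ λs) c
        ≤⟨ covers c ⟩
      conj (unionR k is) c
        ≡⟨ split c ⟩
      conj (R k (suc (toℕ i))) c + conj (unionR k is′) c
        ≤⟨ +-monoˡ-≤ (conj (unionR k is′) c) (≤-trans (conj-R-≤ (suc (toℕ i)) c) (∸-monoʳ-≤ k b≤i)) ⟩
      (k ∸ b) + conj (unionR k is′) c
        ≡⟨ cong (_+ conj (unionR k is′) c) (+-∸-assoc 1 1+b≤k) ⟩
      suc (k ∸ suc b) + conj (unionR k is′) c  ∎)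
      where open ≤-Reasoning

-- Enumerating Y^k_{s+1}

module Enumeration (k : ℕ) where

  open Rectangles k
  open CoverableCount k

  record Coverable (s b r : ℕ) (λs : List ℕ) : Set where
    constructor coverable
    field
      isPartition : IsPartition λs
      bounded     : All (_≤ b) λs
      covered     : Covered s (drop r λs)

  -- Parts are listed from the largest; r counts the rows of the last rectangle still free. When none
  -- are, a new part b opens R_b, whose remaining k ∸ b rows take over the role of r.
  mutual
    coverables : ℕ → ℕ → ℕ → List (List ℕ)
    coverables s zero    r = [] ∷ []
    coverables s (suc b) r = coverables s b r ++ map (suc b ∷_) (extensions s (suc b) r)

    extensions : ℕ → ℕ → ℕ → List (List ℕ)
    extensions s       b (suc r) = coverables s b r
    extensions (suc s) b zero    = coverables s b (k ∸ b)
    extensions zero    b zero    = []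

  InY⇔Coverable : ∀ {s λs} → InY k (suc s) λs ⇔ Coverable s k 0 λs
  InY⇔Coverable = mk⇔
    (λ (partition , bounded , is , λ⊆U) →
      coverable partition bounded (is , Equivalence.to (⊆Y⇔⊆Y′ (proj₁ partition) (unionR-sorted is)) λ⊆U))
    (λ (coverable partition bounded (is , λ⊆′U)) →
      partition , bounded , is , Equivalence.from (⊆Y⇔⊆Y′ (proj₁ partition) (unionR-sorted is)) λ⊆′U)

  length-coverables : ∀ {s b r} → b ≤ k → length (coverables s b r) ≡ coverableCount s b r
  length-coverables {s} {zero} {r} _ = sym (coverableCount-base s r)
  length-coverables {s} {suc b} {r} 1+b≤k = begin
    length (coverables s (suc b) r)
      ≡⟨ length-++ (coverables s b r) ⟩
    length (coverables s b r) + length (map (suc b ∷_) (extensions s (suc b) r))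
      ≡⟨ cong₂ _+_ (length-coverables (≤-trans (n≤1+n b) 1+b≤k))
                   (length-map (suc b ∷_) (extensions s (suc b) r)) ⟩
    coverableCount s b r + length (extensions s (suc b) r)
      ≡⟨ extension-count s r ⟩
    coverableCount s (suc b) r  ∎
    where
    open ≡-Reasoning
    extension-count : ∀ s r → coverableCount s b r + length (extensions s (suc b) r) ≡ coverableCount s (suc b) r
    extension-count s (suc r) = trans (cong (coverableCount s b (suc r) +_) (length-coverables 1+b≤k))
                                      (sym (coverableCount-pascal s b r))
    extension-count (suc s) zero = begin
      coverableCount (suc s) b 0 + length (coverables s (suc b) (k ∸ suc b))
        ≡⟨ cong (coverableCount (suc s) b 0 +_) (length-coverables 1+b≤k) ⟩
      coverableCount (suc s) b 0 + coverableCount s (suc b) (k ∸ suc b)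
        ≡⟨ cong (coverableCount (suc s) b 0 +_) (coverableCount-diagonal s 1+b≤k) ⟩
      coverableCount (suc s) b 0 + (k C suc b) * suc s ^ suc b
        ≡⟨ coverableCount-step (suc s) b ⟨
      coverableCount (suc s) (suc b) 0  ∎
    extension-count zero zero = begin
      coverableCount 0 b 0 + 0                       ≡⟨ cong (coverableCount 0 b 0 +_) (*-zeroʳ (k C suc b)) ⟨
      coverableCount 0 b 0 + (k C suc b) * 0 ^ suc b ≡⟨ coverableCount-step 0 b ⟨
      coverableCount 0 (suc b) 0                     ∎

  partition-∷ : ∀ {b λs} → IsPartition λs → All (_≤ suc b) λs → IsPartition (suc b ∷ λs)
  partition-∷ {λs = []} _ _ = [-] , s≤s z≤n ∷ []
  partition-∷ {λs = _ ∷ _} (sorted , positive) (x≤1+b ∷ _) = x≤1+b ∷ sorted , s≤s z≤n ∷ positive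

  partition-∷⁻ : ∀ {x λs} → IsPartition (x ∷ λs) → IsPartition λs
  partition-∷⁻ (sorted , _ ∷ positive) = Linked.tail sorted , positive

  coverable-∷ : ∀ {s b r λs} → Coverable s (suc b) r λs → Coverable s (suc b) (suc r) (suc b ∷ λs)
  coverable-∷ (coverable partition bounded covered) =
    coverable (partition-∷ partition bounded) (≤-refl ∷ bounded) covered

  coverable-∷⁻ : ∀ {s b r λs} → Coverable s (suc b) (suc r) (suc b ∷ λs) → Coverable s (suc b) r λs
  coverable-∷⁻ (coverable partition (_ ∷ bounded) covered) = coverable (partition-∷⁻ partition) bounded covered

  coverable-mono : ∀ {s b r λs} → Coverable s b r λs → Coverable s (suc b) r λs
  coverable-mono (coverable partition bounded covered) = coverable partition (All.map m≤n⇒m≤1+n bounded) covered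

  coverable-narrow : ∀ {s b r λs} → Coverable s (suc b) r λs →
    Coverable s b r λs ⊎ ∃ λ λs′ → λs ≡ suc b ∷ λs′
  coverable-narrow (coverable partition [] covered) = inj₁ (coverable partition [] covered)
  coverable-narrow {λs = x ∷ λs} (coverable partition (x≤1+b ∷ _) covered) with m≤n⇒m<n∨m≡n x≤1+b
  ... | inj₂ refl = inj₂ (λs , refl)
  ... | inj₁ (s≤s x≤b) = inj₁ (coverable partition (descending⇒All≤ (proj₁ partition) x≤b) covered)

  ∈-coverables⁻ : ∀ {s b r λs} → λs ∈ coverables s (suc b) r →
    λs ∈ coverables s b r ⊎ ∃ λ λs′ → λs ≡ suc b ∷ λs′ × λs′ ∈ extensions s (suc b) r
  ∈-coverables⁻ {s} {b} {r} λs∈ with ∈-++⁻ (coverables s b r) λs∈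
  ... | inj₁ λs∈coverables = inj₁ λs∈coverables
  ... | inj₂ λs∈map with map∷⁻ λs∈map
  ...   | λs′ , λs′∈ , refl = inj₂ (λs′ , refl , λs′∈)

  module _ (i₀ : Fin k) where

    mutual
      ∈coverables⇒Coverable : ∀ {s b r λs} → b ≤ k → λs ∈ coverables s b r → Coverable s b r λs
      ∈coverables⇒Coverable {s} {zero} {r} _ (here refl) =
        coverable ([] , []) [] (subst (Covered s) (sym (drop-[] r)) (covered-[] i₀ s))
      ∈coverables⇒Coverable {s} {suc b} {r} 1+b≤k λs∈ with ∈-coverables⁻ {s} {b} {r} λs∈
      ... | inj₁ λs∈coverables = coverable-mono (∈coverables⇒Coverable (≤-trans (n≤1+n b) 1+b≤k) λs∈coverables)
      ... | inj₂ (λs′ , refl , λs′∈) = ∈extensions⇒Coverable 1+b≤k λs′∈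

      ∈extensions⇒Coverable : ∀ {s b r λs} → suc b ≤ k → λs ∈ extensions s (suc b) r →
        Coverable s (suc b) r (suc b ∷ λs)
      ∈extensions⇒Coverable {r = suc r} 1+b≤k λs∈ = coverable-∷ (∈coverables⇒Coverable 1+b≤k λs∈)
      ∈extensions⇒Coverable {suc s} {b} {zero} {λs} 1+b≤k λs∈
        with ∈coverables⇒Coverable 1+b≤k λs∈
      ... | coverable partition bounded covered =
        coverable partition′ (≤-refl ∷ bounded) (covered-∷⁺ (proj₁ partition′) 1+b≤k covered)
        where
        partition′ : IsPartition (suc b ∷ λs)
        partition′ = partition-∷ partition bounded

    mutual
      Coverable⇒∈coverables : ∀ {s b r λs} → b ≤ k → Coverable s b r λs → λs ∈ coverables s b r
      Coverable⇒∈coverables {b = zero} {λs = []} _ _ = here refl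
      Coverable⇒∈coverables {b = zero} _ (coverable (_ , 1≤x ∷ _) (x≤0 ∷ _) _) = ⊥-elim (<⇒≱ 1≤x x≤0)
      Coverable⇒∈coverables {s} {suc b} {r} 1+b≤k λs-coverable with coverable-narrow λs-coverable
      ... | inj₁ coverable′ = ∈-++⁺ˡ (Coverable⇒∈coverables (≤-trans (n≤1+n b) 1+b≤k) coverable′)
      ... | inj₂ (λs′ , refl) =
        ∈-++⁺ʳ (coverables s b r) (∈-map⁺ (suc b ∷_) (Coverable⇒∈extensions 1+b≤k λs-coverable))

      Coverable⇒∈extensions : ∀ {s b r λs} → suc b ≤ k → Coverable s (suc b) r (suc b ∷ λs) →
        λs ∈ extensions s (suc b) r
      Coverable⇒∈extensions {r = suc r} 1+b≤k λs-coverable =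
        Coverable⇒∈coverables 1+b≤k (coverable-∷⁻ λs-coverable)
      Coverable⇒∈extensions {suc s} {r = zero} 1+b≤k (coverable partition (_ ∷ bounded) covered) =
        Coverable⇒∈coverables 1+b≤k
          (coverable (partition-∷⁻ partition) bounded (covered-∷⁻ (proj₁ partition) 1+b≤k covered))
      Coverable⇒∈extensions {zero} {r = zero} _ (coverable _ _ covered) = ⊥-elim (¬covered-by-none covered)

    ∈coverables⇔Coverable : ∀ {s b r λs} → b ≤ k → (λs ∈ coverables s b r) ⇔ Coverable s b r λs
    ∈coverables⇔Coverable b≤k = mk⇔ (∈coverables⇒Coverable b≤k) (Coverable⇒∈coverables b≤k)

    mutual
      coverables-unique : ∀ {s b r} → b ≤ k → Unique (coverables s b r)
      coverables-unique {b = zero} _ = [] ∷ []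
      coverables-unique {s} {suc b} {r} 1+b≤k =
        UniqueProperties.++⁺ (coverables-unique {s} {b} {r} b≤k)
          (UniqueProperties.map⁺ ∷-injectiveʳ (extensions-unique {s} {b} {r} 1+b≤k)) disjoint
        where
        b≤k : b ≤ k
        b≤k = ≤-trans (n≤1+n b) 1+b≤k
        disjoint : ∀ {λs} → ¬ (λs ∈ coverables s b r × λs ∈ map (suc b ∷_) (extensions s (suc b) r))
        disjoint (λs∈coverables , λs∈map) with map∷⁻ λs∈map
        ... | _ , _ , refl with ∈coverables⇒Coverable b≤k λs∈coverables
        ...   | coverable _ (1+b≤b ∷ _) _ = 1+n≰n 1+b≤b

      extensions-unique : ∀ {s b r} → suc b ≤ k → Unique (extensions s (suc b) r)
      extensions-unique {s} {b} {suc r} 1+b≤k = coverables-unique {s} {suc b} {r} 1+b≤k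
      extensions-unique {suc s} {b} {zero} 1+b≤k = coverables-unique {s} {suc b} {k ∸ suc b} 1+b≤k
      extensions-unique {zero} {r = zero} _ = []

mainTheorem2 : (k m : ℕ) → 1 ≤ k → 1 < m →
    Σ (List (List ℕ)) (λ L → Unique L × (∀ λs → (λs ∈ L) ⇔ InY k m λs) × length L ≡ m ^ k)
mainTheorem2 k@(suc _) (suc s) _ _ =
  coverables s k 0 ,
  coverables-unique Fin.zero {s} {k} {0} ≤-refl ,
  (λ _ → ⇔-trans (∈coverables⇔Coverable Fin.zero ≤-refl) (⇔-sym InY⇔Coverable)) ,
  trans (length-coverables ≤-refl) (coverableCount-total s)
  where
  open CoverableCount k
  open Enumeration k
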